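{- Let $T$ be a finite system of equations, each of one of the forms $S(x)=y$, $x+y=z$, $x\cdot y=z$ (with $x,y,z$ variables), where $S(n)=n+1$ denotes the successor function. Suppose the equation $x+y=z$ belongs to $T$, and let $z_1,z_2,\widetilde{z_1},\widetilde{z_2},\widetilde{v},u,t,\widetilde{t},v$ be variables not occurring in $T$. Then the system \[ \bigl(T\setminus\{x+y=z\}\bigr)\cup\{z\cdot x=z_1,\ z\cdot y=z_2,\ S(z_1)=\widetilde{z_1},\ S(z_2)=\widetilde{z_2},\ \widetilde{z_1}\cdot\widetilde{z_2}=\widetilde{v},\ z\cdot z=u,\ x\cdot y=t,\ S(t)=\widetilde{t},\ u\cdot\widetilde{t}=v,\ S(v)=\widetilde{v}\} \] has the same solutions in positive integers as $T$ (in the sense that, restricted to the variables of $T$, the solution sets coincide) and contains fewer equations of the form $x+y=z$ than $T$. -}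

module Defs where

open import Data.Nat using (ℕ; suc; _+_; _*_; _≤_; _<_; _≟_)
open import Data.List using (List; []; _∷_; _++_; length)
open import Data.List.Membership.Propositional using (_∈_)
open import Data.List.Relation.Unary.All using (All)
open import Data.Product using (_×_)
open import Relation.Binary.PropositionalEquality using (_≡_)
open import Relation.Nullary using (yes; no; ¬_)
open import Relation.Nullary.Decidable using (_×-dec_)

Var : Set
Var = ℕ

data Eqn : Set where
  succE : Var → Var → Eqn
  addE  : Var → Var → Var → Eqn
  mulE  : Var → Var → Var → Eqn

System : Set
System = List Eqn

varsE : Eqn → List Var
varsE (succE x y)  = x ∷ y ∷ []
varsE (addE x y z) = x ∷ y ∷ z ∷ []
varsE (mulE x y z) = x ∷ y ∷ z ∷ []

vars : System → List Var
vars []       = []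
vars (e ∷ es) = varsE e ++ vars es

Assignment : Set
Assignment = Var → ℕ

Positive : Assignment → Set
Positive f = ∀ v → 1 ≤ f v

SatE : Assignment → Eqn → Set
SatE f (succE x y)  = suc (f x) ≡ f y
SatE f (addE x y z) = f x + f y ≡ f z
SatE f (mulE x y z) = f x * f y ≡ f z

Sat : Assignment → System → Set
Sat f T = All (SatE f) T

-- T ∖ {x + y = z}: remove (every copy of) the equation x + y = z.
removeAdd : Var → Var → Var → System → System
removeAdd x y z [] = []
removeAdd x y z (succE a b ∷ es) = succE a b ∷ removeAdd x y z es
removeAdd x y z (mulE a b c ∷ es) = mulE a b c ∷ removeAdd x y z es
removeAdd x y z (addE a b c ∷ es) with (a ≟ x) ×-dec ((b ≟ y) ×-dec (c ≟ z))
... | yes _ = removeAdd x y z es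
... | no  _ = addE a b c ∷ removeAdd x y z es

numAdd : System → ℕ
numAdd [] = 0
numAdd (addE _ _ _ ∷ es) = suc (numAdd es)
numAdd (succE _ _ ∷ es)  = numAdd es
numAdd (mulE _ _ _ ∷ es) = numAdd es

AgreeOn : List Var → Assignment → Assignment → Set
AgreeOn vs f g = All (λ v → f v ≡ g v) vs

{-# OPTIONS --safe #-}
-- Since S(zx) · S(zy) + z² = S(z² · S(xy)) + z(x + y),
-- for positive z the equation S(zx) · S(zy) = S(z² · S(xy)) holds iff z(x + y) = z²,
-- i.e. iff x + y = z. The ten new equations name every product and successor in it
-- by a fresh variable, so a solution of T extends to them by evaluating those terms.
module Submission where

open import Defs
open import Data.Nat using (ℕ; suc; _+_; _*_; _≤_; _<_; _≟_; s≤s; z≤n; NonZero; >-nonZero)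
open import Data.Nat.Properties
  using (+-cancelˡ-≡; +-cancelʳ-≡; *-cancelˡ-≡; *-mono-≤; +-identityʳ; ≤-trans; n≤1+n; module ≤-Reasoning)
open import Data.Nat.Tactic.RingSolver using (solve-∀)
open import Data.List using (List; []; _∷_; _++_; map)
open import Data.List.Membership.Propositional using (_∈_; _∉_)
open import Data.List.Membership.Propositional.Properties using (∈-++⁺ˡ; ∈-++⁺ʳ)
open import Data.List.Relation.Unary.All as All using (All; []; _∷_)
open import Data.List.Relation.Unary.All.Properties using (++⁺; ++⁻; map⁻)
open import Data.List.Relation.Unary.Any using (here; there)
open import Data.List.Relation.Unary.AllPairs using (_∷_)
open import Data.List.Relation.Unary.Unique.Propositional using (Unique)
open import Data.Product using (_×_; ∃; _,_; proj₁; proj₂)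
open import Data.Empty using (⊥-elim)
open import Function using (_∘_)
open import Relation.Nullary using (yes; no)
open import Relation.Nullary.Decidable using (_×-dec_)
open import Relation.Binary.PropositionalEquality
  using (_≡_; _≢_; refl; sym; trans; cong; cong₂; subst₂; module ≡-Reasoning)

product-identity : ∀ a b c →
  suc (c * a) * suc (c * b) + c * c ≡ suc (c * c * suc (a * b)) + c * (a + b)
product-identity = solve-∀

product-of-add : ∀ {a b c} → a + b ≡ c →
  suc (c * a) * suc (c * b) ≡ suc (c * c * suc (a * b))
product-of-add {a} {b} {c} a+b≡c = +-cancelʳ-≡ (c * c) _ _ (begin
  suc (c * a) * suc (c * b) + c * c        ≡⟨ product-identity a b c ⟩
  suc (c * c * suc (a * b)) + c * (a + b)  ≡⟨ cong (λ s → suc (c * c * suc (a * b)) + c * s) a+b≡c ⟩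
  suc (c * c * suc (a * b)) + c * c        ∎)
  where open ≡-Reasoning

add-of-product : ∀ {a b c} .{{_ : NonZero c}} →
  suc (c * a) * suc (c * b) ≡ suc (c * c * suc (a * b)) → a + b ≡ c
add-of-product {a} {b} {c} eq = *-cancelˡ-≡ (a + b) c c (+-cancelˡ-≡ (suc (c * c * suc (a * b))) _ _ (begin
  suc (c * c * suc (a * b)) + c * (a + b)  ≡⟨ product-identity a b c ⟨
  suc (c * a) * suc (c * b) + c * c        ≡⟨ cong (_+ c * c) eq ⟩
  suc (c * c * suc (a * b)) + c * c        ∎))
  where open ≡-Reasoning

SatE-cong : ∀ {f g} e → AgreeOn (varsE e) f g → SatE f e → SatE g e
SatE-cong (succE a b)  (fa ∷ fb ∷ [])      = subst₂ (λ p q → suc p ≡ q) fa fb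
SatE-cong (addE a b c) (fa ∷ fb ∷ fc ∷ []) = subst₂ (λ p q → p ≡ q) (cong₂ _+_ fa fb) fc
SatE-cong (mulE a b c) (fa ∷ fb ∷ fc ∷ []) = subst₂ (λ p q → p ≡ q) (cong₂ _*_ fa fb) fc

Sat-cong : ∀ {f g} T → AgreeOn (vars T) f g → Sat f T → Sat g T
Sat-cong []       _     []       = []
Sat-cong (e ∷ es) agree (s ∷ ss) with ++⁻ (varsE e) agree
... | agree-e , agree-es = SatE-cong e agree-e s ∷ Sat-cong es agree-es ss

∈-vars : ∀ {e w} T → e ∈ T → w ∈ varsE e → w ∈ vars T
∈-vars (e ∷ es) (here refl) w∈e = ∈-++⁺ˡ w∈e
∈-vars (e ∷ es) (there e∈es) w∈e = ∈-++⁺ʳ (varsE e) (∈-vars es e∈es w∈e)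

removeAdd-sat : ∀ {f} x y z T → Sat f T → Sat f (removeAdd x y z T)
removeAdd-sat x y z []                []       = []
removeAdd-sat x y z (succE a b ∷ es)  (s ∷ ss) = s ∷ removeAdd-sat x y z es ss
removeAdd-sat x y z (mulE a b c ∷ es) (s ∷ ss) = s ∷ removeAdd-sat x y z es ss
removeAdd-sat x y z (addE a b c ∷ es) (s ∷ ss) with (a ≟ x) ×-dec ((b ≟ y) ×-dec (c ≟ z))
... | yes _ = removeAdd-sat x y z es ss
... | no  _ = s ∷ removeAdd-sat x y z es ss

removeAdd-sat⁻ : ∀ {f} x y z T → Sat f (removeAdd x y z T) → SatE f (addE x y z) → Sat f T
removeAdd-sat⁻ x y z []                _        _ = []
removeAdd-sat⁻ x y z (succE a b ∷ es)  (s ∷ ss) q = s ∷ removeAdd-sat⁻ x y z es ss q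
removeAdd-sat⁻ x y z (mulE a b c ∷ es) (s ∷ ss) q = s ∷ removeAdd-sat⁻ x y z es ss q
removeAdd-sat⁻ x y z (addE a b c ∷ es) ss       q with (a ≟ x) ×-dec ((b ≟ y) ×-dec (c ≟ z))
removeAdd-sat⁻ x y z (addE a b c ∷ es) ss       q | yes (refl , refl , refl) = q ∷ removeAdd-sat⁻ x y z es ss q
removeAdd-sat⁻ x y z (addE a b c ∷ es) (s ∷ ss) q | no _ = s ∷ removeAdd-sat⁻ x y z es ss q

numAdd-++ : ∀ S T → numAdd (S ++ T) ≡ numAdd S + numAdd T
numAdd-++ []                T = refl
numAdd-++ (succE _ _ ∷ S)   T = numAdd-++ S T
numAdd-++ (mulE _ _ _ ∷ S)  T = numAdd-++ S T
numAdd-++ (addE _ _ _ ∷ S)  T = cong suc (numAdd-++ S T)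

numAdd-removeAdd-≤ : ∀ x y z T → numAdd (removeAdd x y z T) ≤ numAdd T
numAdd-removeAdd-≤ x y z []                = z≤n
numAdd-removeAdd-≤ x y z (succE a b ∷ es)  = numAdd-removeAdd-≤ x y z es
numAdd-removeAdd-≤ x y z (mulE a b c ∷ es) = numAdd-removeAdd-≤ x y z es
numAdd-removeAdd-≤ x y z (addE a b c ∷ es) with (a ≟ x) ×-dec ((b ≟ y) ×-dec (c ≟ z))
... | yes _ = ≤-trans (numAdd-removeAdd-≤ x y z es) (n≤1+n _)
... | no  _ = s≤s (numAdd-removeAdd-≤ x y z es)

numAdd-removeAdd-< : ∀ x y z T → addE x y z ∈ T → numAdd (removeAdd x y z T) < numAdd T
numAdd-removeAdd-< x y z (addE x y z ∷ es) (here refl) with (x ≟ x) ×-dec ((y ≟ y) ×-dec (z ≟ z))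
... | yes _ = s≤s (numAdd-removeAdd-≤ x y z es)
... | no ≢  = ⊥-elim (≢ (refl , refl , refl))
numAdd-removeAdd-< x y z (succE a b ∷ es)  (there p) = numAdd-removeAdd-< x y z es p
numAdd-removeAdd-< x y z (mulE a b c ∷ es) (there p) = numAdd-removeAdd-< x y z es p
numAdd-removeAdd-< x y z (addE a b c ∷ es) (there p) with (a ≟ x) ×-dec ((b ≟ y) ×-dec (c ≟ z))
... | yes _ = ≤-trans (numAdd-removeAdd-< x y z es p) (n≤1+n _)
... | no  _ = s≤s (numAdd-removeAdd-< x y z es p)

override : List (Var × ℕ) → Assignment → Assignment
override []             f w = f w
override ((k , n) ∷ ps) f w with w ≟ k
... | yes _ = n
... | no  _ = override ps f w

override-here : ∀ k n ps f → override ((k , n) ∷ ps) f k ≡ n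
override-here k n ps f with k ≟ k
... | yes _ = refl
... | no  k≢k = ⊥-elim (k≢k refl)

override-there : ∀ {w} k n ps f → w ≢ k → override ((k , n) ∷ ps) f w ≡ override ps f w
override-there {w} k n ps f w≢k with w ≟ k
... | yes w≡k = ⊥-elim (w≢k w≡k)
... | no  _   = refl

override-∉ : ∀ {w} ps f → w ∉ map proj₁ ps → override ps f w ≡ f w
override-∉ []             f w∉ = refl
override-∉ ((k , n) ∷ ps) f w∉ =
  trans (override-there k n ps f (w∉ ∘ here)) (override-∉ ps f (w∉ ∘ there))

override-lookup : ∀ ps f → Unique (map proj₁ ps) → All (λ p → override ps f (proj₁ p) ≡ proj₂ p) ps
override-lookup []             f _                 = []
override-lookup ((k , n) ∷ ps) f (k∉ps ∷ distinct) =
  override-here k n ps f ∷ All.zipWith shadow (map⁻ k∉ps , override-lookup ps f distinct)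
  where
  shadow : ∀ {p} → k ≢ proj₁ p × override ps f (proj₁ p) ≡ proj₂ p →
           override ((k , n) ∷ ps) f (proj₁ p) ≡ proj₂ p
  shadow (k≢ , eq) = trans (override-there k n ps f (k≢ ∘ sym)) eq

override-positive : ∀ ps f → All (λ p → 1 ≤ proj₂ p) ps → Positive f → Positive (override ps f)
override-positive []             f []            f>0 w = f>0 w
override-positive ((k , n) ∷ ps) f (n>0 ∷ ps>0) f>0 w with w ≟ k
... | yes _ = n>0
... | no  _ = override-positive ps f ps>0 f>0 w

module AdditionGadget (x y z z₁ z₂ z̃₁ z̃₂ ṽ u t t̃ v : Var) where

  equations : System
  equations = mulE z x z₁ ∷ mulE z y z₂ ∷ succE z₁ z̃₁ ∷ succE z₂ z̃₂ ∷
              mulE z̃₁ z̃₂ ṽ ∷ mulE z z u ∷ mulE x y t ∷ succE t t̃ ∷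
              mulE u t̃ v ∷ succE v ṽ ∷ []

  private
    product-side : ∀ {g} → SatE g (mulE z x z₁) → SatE g (mulE z y z₂) →
      SatE g (succE z₁ z̃₁) → SatE g (succE z₂ z̃₂) →
      suc (g z * g x) * suc (g z * g y) ≡ g z̃₁ * g z̃₂
    product-side e₁ e₂ e₃ e₄ = cong₂ _*_ (trans (cong suc e₁) e₃) (trans (cong suc e₂) e₄)

    square-side : ∀ {g} → SatE g (mulE z z u) → SatE g (mulE x y t) →
      SatE g (succE t t̃) → SatE g (mulE u t̃ v) → SatE g (succE v ṽ) →
      suc (g z * g z * suc (g x * g y)) ≡ g ṽ
    square-side e₆ e₇ e₈ e₉ e₁₀ =
      trans (cong suc (trans (cong₂ _*_ e₆ (trans (cong suc e₇) e₈)) e₉)) e₁₀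

  sound : ∀ {g} → 1 ≤ g z → Sat g equations → SatE g (addE x y z)
  sound z>0 (e₁ ∷ e₂ ∷ e₃ ∷ e₄ ∷ e₅ ∷ e₆ ∷ e₇ ∷ e₈ ∷ e₉ ∷ e₁₀ ∷ []) =
    add-of-product {{>-nonZero z>0}}
      (trans (product-side e₁ e₂ e₃ e₄) (trans e₅ (sym (square-side e₆ e₇ e₈ e₉ e₁₀))))

  complete : ∀ {g} → SatE g (addE x y z) →
    SatE g (mulE z x z₁) → SatE g (mulE z y z₂) → SatE g (succE z₁ z̃₁) → SatE g (succE z₂ z̃₂) →
    SatE g (mulE z z u) → SatE g (mulE x y t) → SatE g (succE t t̃) → SatE g (mulE u t̃ v) →
    SatE g (succE v ṽ) → Sat g equations
  complete x+y≡z e₁ e₂ e₃ e₄ e₆ e₇ e₈ e₉ e₁₀ =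
    e₁ ∷ e₂ ∷ e₃ ∷ e₄ ∷ e₅ ∷ e₆ ∷ e₇ ∷ e₈ ∷ e₉ ∷ e₁₀ ∷ []
    where
    e₅ = trans (sym (product-side e₁ e₂ e₃ e₄)) (trans (product-of-add x+y≡z) (square-side e₆ e₇ e₈ e₉ e₁₀))

  fresh : List Var
  fresh = z₁ ∷ z₂ ∷ z̃₁ ∷ z̃₂ ∷ ṽ ∷ u ∷ t ∷ t̃ ∷ v ∷ []

  witness : Assignment → List (Var × ℕ)
  witness f =
    (z₁ , Z * X) ∷ (z₂ , Z * Y) ∷ (z̃₁ , suc (Z * X)) ∷ (z̃₂ , suc (Z * Y)) ∷
    (ṽ , suc (Z * Z * suc (X * Y))) ∷ (u , Z * Z) ∷ (t , X * Y) ∷ (t̃ , suc (X * Y)) ∷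
    (v , Z * Z * suc (X * Y)) ∷ []
    where X = f x; Y = f y; Z = f z

  extend : Assignment → Assignment
  extend f = override (witness f) f

  extend-agrees : ∀ {f w} → w ∉ fresh → f w ≡ extend f w
  extend-agrees {f} w∉ = sym (override-∉ (witness f) f w∉)

  extend-positive : ∀ {f} → Positive f → Positive (extend f)
  extend-positive {f} f>0 = override-positive (witness f) f
    (zx>0 ∷ zy>0 ∷ s≤s z≤n ∷ s≤s z≤n ∷ s≤s z≤n ∷ *-mono-≤ z>0 z>0 ∷ *-mono-≤ x>0 y>0 ∷
     s≤s z≤n ∷ *-mono-≤ (*-mono-≤ z>0 z>0) (s≤s z≤n) ∷ []) f>0
    where
    x>0 = f>0 x; y>0 = f>0 y; z>0 = f>0 z
    zx>0 = *-mono-≤ z>0 x>0; zy>0 = *-mono-≤ z>0 y>0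

  extend-sat : ∀ {f} → Unique fresh → SatE f (addE x y z) →
    AgreeOn (x ∷ y ∷ z ∷ []) f (extend f) → Sat (extend f) equations
  extend-sat {f} distinct x+y≡z agree@(fx ∷ fy ∷ fz ∷ [])
    with override-lookup (witness f) f distinct
  ... | g₁ ∷ g₂ ∷ g̃₁ ∷ g̃₂ ∷ gṽ ∷ gu ∷ gt ∷ gt̃ ∷ gv ∷ [] =
    complete (SatE-cong (addE x y z) agree x+y≡z)
      (trans (cong₂ _*_ gz gx) (sym g₁)) (trans (cong₂ _*_ gz gy) (sym g₂))
      (trans (cong suc g₁) (sym g̃₁)) (trans (cong suc g₂) (sym g̃₂))
      (trans (cong₂ _*_ gz gz) (sym gu)) (trans (cong₂ _*_ gx gy) (sym gt))
      (trans (cong suc gt) (sym gt̃)) (trans (cong₂ _*_ gu gt̃) (sym gv)) (trans (cong suc gv) (sym gṽ))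
    where
    gx = sym fx; gy = sym fy; gz = sym fz

lemma3 : (T : System) (x y z : Var) → addE x y z ∈ T →
  (z₁ z₂ z̃₁ z̃₂ ṽ u t t̃ v : Var) →
  Unique (z₁ ∷ z₂ ∷ z̃₁ ∷ z̃₂ ∷ ṽ ∷ u ∷ t ∷ t̃ ∷ v ∷ []) →
  All (λ w → w ∉ vars T) (z₁ ∷ z₂ ∷ z̃₁ ∷ z̃₂ ∷ ṽ ∷ u ∷ t ∷ t̃ ∷ v ∷ []) →
  let T′ = removeAdd x y z T ++
             (mulE z x z₁ ∷ mulE z y z₂ ∷ succE z₁ z̃₁ ∷ succE z₂ z̃₂ ∷
              mulE z̃₁ z̃₂ ṽ ∷ mulE z z u ∷ mulE x y t ∷ succE t t̃ ∷
              mulE u t̃ v ∷ succE v ṽ ∷ [])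
  in ((f : Assignment) → Positive f → Sat f T →
        ∃ λ g → Positive g × Sat g T′ × AgreeOn (vars T) f g)
   × ((g : Assignment) → Positive g → Sat g T′ →
        ∃ λ f → Positive f × Sat f T × AgreeOn (vars T) f g)
   × (numAdd T′ < numAdd T)
lemma3 T x y z x+y=z∈T z₁ z₂ z̃₁ z̃₂ ṽ u t t̃ v distinct fresh∉T = forward , backward , fewer
  where
  open AdditionGadget x y z z₁ z₂ z̃₁ z̃₂ ṽ u t t̃ v

  forward : (f : Assignment) → Positive f → Sat f T →
    ∃ λ g → Positive g × Sat g (removeAdd x y z T ++ equations) × AgreeOn (vars T) f g
  forward f f>0 f⊨T =
    extend f , extend-positive f>0 ,
    ++⁺ (removeAdd-sat x y z T (Sat-cong T agree f⊨T))
        (extend-sat distinct (All.lookup f⊨T x+y=z∈T) (All.tabulate (All.lookup agree ∘ ∈-vars T x+y=z∈T))) ,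
    agree
    where
    agree : AgreeOn (vars T) f (extend f)
    agree = All.tabulate λ w∈T → extend-agrees λ w∈fresh → All.lookup fresh∉T w∈fresh w∈T

  backward : (g : Assignment) → Positive g → Sat g (removeAdd x y z T ++ equations) →
    ∃ λ f → Positive f × Sat f T × AgreeOn (vars T) f g
  backward g g>0 g⊨T′ with ++⁻ (removeAdd x y z T) g⊨T′
  ... | g⊨R , g⊨E = g , g>0 , removeAdd-sat⁻ x y z T g⊨R (sound (g>0 z) g⊨E) , All.tabulate λ _ → refl

  fewer : numAdd (removeAdd x y z T ++ equations) < numAdd T
  fewer = begin-strict
    numAdd (removeAdd x y z T ++ equations)  ≡⟨ numAdd-++ (removeAdd x y z T) equations ⟩
    numAdd (removeAdd x y z T) + 0           ≡⟨ +-identityʳ _ ⟩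
    numAdd (removeAdd x y z T)               <⟨ numAdd-removeAdd-< x y z T x+y=z∈T ⟩
    numAdd T                                 ∎
    where open ≤-Reasoning
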